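{- Let $r\ge 3$ be odd. Every complete bipartite graph $K_{s,t}$ of order $s+t\ge r$ is $r$-void.
   Context: For a graph $G$ of order $n$ and an integer $r$ with $2<r\le n$: $G$ is called $r$-complete if every subgraph of $G$ induced by $r$ vertices has an odd number of edges; $r$-void if every subgraph induced by $r$ vertices has an even number of edges; and $r$-neutral if it is neither $r$-complete nor $r$-void. -}

module Defs where

open import Data.Nat using (ℕ; zero; suc; _+_; _<_; _≤_; _<ᵇ_; _<?_)
open import Data.Nat.Divisibility using (_∣_)
import Data.Bool.Properties
open import Data.Bool.Properties using () renaming (_≟_ to _≟B_)
open import Data.Bool using (Bool; true; false; _xor_)
open import Data.Fin using (Fin; toℕ)
open import Data.Fin.Subset using (Subset; _∈_; ∣_∣)
open import Data.Vec using (lookup)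
open import Data.List using (List; []; _∷_; length; filter; allFin; concatMap; map)
open import Data.Product using (_×_; _,_; proj₁; proj₂)
open import Relation.Binary.PropositionalEquality using (_≡_)
open import Relation.Nullary using (¬_)

record Graph (n : ℕ) : Set where
  field
    adj   : Fin n → Fin n → Bool
    sym   : ∀ i j → adj i j ≡ adj j i
    irrefl : ∀ i → adj i i ≡ false
open Graph public

-- All pairs (i , j) of vertices with toℕ i < toℕ j (unordered pairs, each once).
orderedPairs : (n : ℕ) → List (Fin n × Fin n)
orderedPairs n =
  concatMap (λ i → map (λ j → (i , j)) (filter (λ j → toℕ i <? toℕ j) (allFin n))) (allFin n)

inducedEdges : ∀ {n} → Graph n → Subset n → ℕ
inducedEdges {n} G S =
  length (filter (λ p → lookup S (proj₁ p) ≟B true)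
         (filter (λ p → lookup S (proj₂ p) ≟B true)
         (filter (λ p → adj G (proj₁ p) (proj₂ p) ≟B true) (orderedPairs n))))

Void : ∀ {n} → ℕ → Graph n → Set
Void {n} r G = ∀ (S : Subset n) → ∣ S ∣ ≡ r → 2 ∣ inducedEdges G S

Complete : ∀ {n} → ℕ → Graph n → Set
Complete {n} r G = ∀ (S : Subset n) → ∣ S ∣ ≡ r → ¬ (2 ∣ inducedEdges G S)

-- Complete bipartite graph K_{s,t} on Fin (s + t): vertices with index < s form
-- one part, the remaining t vertices the other; two vertices are adjacent iff
-- they lie in different parts.
inFirst : ∀ {s t} → Fin (s + t) → Bool
inFirst {s} i = toℕ i <ᵇ s

K : (s t : ℕ) → Graph (s + t)
K s t = record
  { adj = λ i j → inFirst {s} {t} i xor inFirst {s} {t} j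
  ; sym = λ i j → Data.Bool.Properties.xor-comm (inFirst {s} {t} i) (inFirst {s} {t} j)
  ; irrefl = λ i → Data.Bool.Properties.xor-same (inFirst {s} {t} i)
  }

-- Split an r-set S of vertices of K_{s,t} as a vertices in the first part and
-- b in the second. The induced edges are exactly the a·b pairs joining the two
-- parts, while a + b = r is odd; so one of a, b is even and so is a·b.
module Submission where

open import Defs hiding (sym)
open import Algebra.Bundles using (CommutativeMonoid)
open import Data.Bool using (Bool; true; false; not; _∧_; _xor_; if_then_else_)
open import Data.Bool.Properties using (∧-assoc; ∧-comm; ∧-commutativeMonoid) renaming (_≟_ to _≟B_)
open import Data.Fin as Fin using (Fin; toℕ)
open import Data.Fin.Subset using (Subset; ∣_∣)
open import Data.List using (List; []; _∷_; _++_; length; map; concatMap; filter; allFin; tabulate)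
open import Data.List.Properties using (map-cong; map-tabulate)
open import Data.Nat using (ℕ; suc; _+_; _*_; _≤_; _<ᵇ_; _<?_; _%_; s≤s)
open import Data.Nat.DivMod using (m%n<n; %-distribˡ-+)
open import Data.Nat.Divisibility using (_∣_; _∣?_; ∣m⇒∣m*n; ∣n⇒∣m*n; m%n≡0⇒n∣m)
open import Data.Nat.ListAction using (sum)
open import Data.Nat.Properties using (+-suc; <-trans; <-≤-trans; ≮⇒≥; <ᵇ-reflects-<)
open import Data.Product using (_×_; _,_; proj₁; proj₂)
open import Data.Vec using (lookup; _∷_; [])
open import Function using (_∘_)
open import Relation.Binary.PropositionalEquality
  using (_≡_; _≗_; refl; sym; trans; cong; cong₂; subst; module ≡-Reasoning)
open import Relation.Nullary using (¬_; does; yes; no; contradiction)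
open import Relation.Nullary.Reflects using (ofʸ; ofⁿ)
open import Relation.Unary using (Pred; Decidable)

open import Algebra.Properties.CommutativeSemigroup
  (CommutativeMonoid.commutativeSemigroup ∧-commutativeMonoid) using (interchange)

open ≡-Reasoning

countᵇ : ∀ {a} {A : Set a} → (A → Bool) → List A → ℕ
countᵇ p []       = 0
countᵇ p (x ∷ xs) = if p x then suc (countᵇ p xs) else countᵇ p xs

countᵇ-cong : ∀ {a} {A : Set a} {p q : A → Bool} → p ≗ q → countᵇ p ≗ countᵇ q
countᵇ-cong         p≗q []       = refl
countᵇ-cong {q = q} p≗q (x ∷ xs) rewrite p≗q x with q x
... | true  = cong suc (countᵇ-cong p≗q xs)
... | false = countᵇ-cong p≗q xs

countᵇ-false : ∀ {a} {A : Set a} (xs : List A) → countᵇ (λ _ → false) xs ≡ 0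
countᵇ-false []       = refl
countᵇ-false (x ∷ xs) = countᵇ-false xs

countᵇ-++ : ∀ {a} {A : Set a} (p : A → Bool) xs ys →
  countᵇ p (xs ++ ys) ≡ countᵇ p xs + countᵇ p ys
countᵇ-++ p []       ys = refl
countᵇ-++ p (x ∷ xs) ys with p x
... | true  = cong suc (countᵇ-++ p xs ys)
... | false = countᵇ-++ p xs ys

countᵇ-map : ∀ {a b} {A : Set a} {B : Set b} (p : B → Bool) (f : A → B) xs →
  countᵇ p (map f xs) ≡ countᵇ (p ∘ f) xs
countᵇ-map p f []       = refl
countᵇ-map p f (x ∷ xs) with p (f x)
... | true  = cong suc (countᵇ-map p f xs)
... | false = countᵇ-map p f xs

countᵇ-concatMap : ∀ {a b} {A : Set a} {B : Set b} (p : B → Bool) (f : A → List B) xs →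
  countᵇ p (concatMap f xs) ≡ sum (map (countᵇ p ∘ f) xs)
countᵇ-concatMap p f []       = refl
countᵇ-concatMap p f (x ∷ xs) = trans
  (countᵇ-++ p (f x) (concatMap f xs))
  (cong (countᵇ p (f x) +_) (countᵇ-concatMap p f xs))

length-filter≡countᵇ : ∀ {a ℓ} {A : Set a} {P : Pred A ℓ} (P? : Decidable P) xs →
  length (filter P? xs) ≡ countᵇ (does ∘ P?) xs
length-filter≡countᵇ P? []       = refl
length-filter≡countᵇ P? (x ∷ xs) with does (P? x)
... | true  = cong suc (length-filter≡countᵇ P? xs)
... | false = length-filter≡countᵇ P? xs

countᵇ-filter : ∀ {a ℓ} {A : Set a} {P : Pred A ℓ} (P? : Decidable P) (p : A → Bool) xs →
  countᵇ p (filter P? xs) ≡ countᵇ (λ x → does (P? x) ∧ p x) xs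
countᵇ-filter P? p []       = refl
countᵇ-filter P? p (x ∷ xs) with does (P? x)
... | false = countᵇ-filter P? p xs
... | true  with p x
...   | true  = cong suc (countᵇ-filter P? p xs)
...   | false = countᵇ-filter P? p xs

countᵇ-split : ∀ {a} {A : Set a} (q p : A → Bool) xs →
  countᵇ p xs ≡ countᵇ (λ x → q x ∧ p x) xs + countᵇ (λ x → not (q x) ∧ p x) xs
countᵇ-split q p []       = refl
countᵇ-split q p (x ∷ xs) with q x | p x
... | true  | false = countᵇ-split q p xs
... | false | false = countᵇ-split q p xs
... | true  | true  = cong suc (countᵇ-split q p xs)
... | false | true  = begin
  suc (countᵇ p xs) ≡⟨ cong suc (countᵇ-split q p xs) ⟩
  suc (m + n)       ≡⟨ +-suc m n ⟨
  m + suc n         ∎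
  where
  m n : ℕ
  m = countᵇ (λ x → q x ∧ p x) xs
  n = countᵇ (λ x → not (q x) ∧ p x) xs

sum-countᵇ-∧ : ∀ {a b} {A : Set a} {B : Set b} (p : A → Bool) (q : B → Bool) xs ys →
  sum (map (λ x → countᵇ (λ y → p x ∧ q y) ys) xs) ≡ countᵇ p xs * countᵇ q ys
sum-countᵇ-∧ p q []       ys = refl
sum-countᵇ-∧ p q (x ∷ xs) ys with p x
... | true  = cong (countᵇ q ys +_) (sum-countᵇ-∧ p q xs ys)
... | false = cong₂ _+_ (countᵇ-false ys) (sum-countᵇ-∧ p q xs ys)

countᵇ-tabulate-suc : ∀ {n} (p : Fin (suc n) → Bool) →
  countᵇ p (tabulate Fin.suc) ≡ countᵇ (p ∘ Fin.suc) (allFin n)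
countᵇ-tabulate-suc {n} p = trans
  (cong (countᵇ p) (sym (map-tabulate (λ i → i) Fin.suc)))
  (countᵇ-map p Fin.suc (allFin n))

∣p∣≡countᵇ : ∀ {n} (p : Subset n) → ∣ p ∣ ≡ countᵇ (lookup p) (allFin n)
∣p∣≡countᵇ []      = refl
∣p∣≡countᵇ (x ∷ p) with x
... | true  = cong suc (trans (∣p∣≡countᵇ p) (sym (countᵇ-tabulate-suc (lookup (true ∷ p)))))
... | false = trans (∣p∣≡countᵇ p) (sym (countᵇ-tabulate-suc (lookup (false ∷ p))))

-- does (m <? n) computes to m <ᵇ n, so the filter of orderedPairs becomes a
-- Boolean conjunct here.
countᵇ-orderedPairs : ∀ {n} (p : Fin n × Fin n → Bool) →
  countᵇ p (orderedPairs n) ≡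
  sum (map (λ i → countᵇ (λ j → (toℕ i <ᵇ toℕ j) ∧ p (i , j)) (allFin n)) (allFin n))
countᵇ-orderedPairs {n} p = trans
  (countᵇ-concatMap p row (allFin n))
  (cong sum (map-cong count-row (allFin n)))
  where
  row : Fin n → List (Fin n × Fin n)
  row i = map (i ,_) (filter (λ j → toℕ i <? toℕ j) (allFin n))
  count-row : ∀ i → countᵇ p (row i) ≡ countᵇ (λ j → (toℕ i <ᵇ toℕ j) ∧ p (i , j)) (allFin n)
  count-row i = trans
    (countᵇ-map p (i ,_) (filter (λ j → toℕ i <? toℕ j) (allFin n)))
    (countᵇ-filter (λ j → toℕ i <? toℕ j) (p ∘ (i ,_)) (allFin n))

does-≟-true : ∀ b → does (b ≟B true) ≡ b
does-≟-true true  = refl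
does-≟-true false = refl

inducedEdges≡countᵇ : ∀ {n} (G : Graph n) (S : Subset n) →
  inducedEdges G S ≡
  countᵇ (λ e → adj G (proj₁ e) (proj₂ e) ∧ (lookup S (proj₂ e) ∧ lookup S (proj₁ e))) (orderedPairs n)
inducedEdges≡countᵇ {n} G S = begin
  inducedEdges G S
    ≡⟨ length-filter≡countᵇ S₁? (filter S₂? (filter G? (orderedPairs n))) ⟩
  countᵇ (does ∘ S₁?) (filter S₂? (filter G? (orderedPairs n)))
    ≡⟨ countᵇ-filter S₂? (does ∘ S₁?) (filter G? (orderedPairs n)) ⟩
  countᵇ (λ e → does (S₂? e) ∧ does (S₁? e)) (filter G? (orderedPairs n))
    ≡⟨ countᵇ-filter G? (λ e → does (S₂? e) ∧ does (S₁? e)) (orderedPairs n) ⟩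
  countᵇ (λ e → does (G? e) ∧ (does (S₂? e) ∧ does (S₁? e))) (orderedPairs n)
    ≡⟨ countᵇ-cong does-all (orderedPairs n) ⟩
  countᵇ (λ e → adj G (proj₁ e) (proj₂ e) ∧ (lookup S (proj₂ e) ∧ lookup S (proj₁ e))) (orderedPairs n) ∎
  where
  S₁? : Decidable (λ (e : Fin n × Fin n) → lookup S (proj₁ e) ≡ true)
  S₂? : Decidable (λ (e : Fin n × Fin n) → lookup S (proj₂ e) ≡ true)
  G?  : Decidable (λ (e : Fin n × Fin n) → adj G (proj₁ e) (proj₂ e) ≡ true)
  S₁? e = lookup S (proj₁ e) ≟B true
  S₂? e = lookup S (proj₂ e) ≟B true
  G?  e = adj G (proj₁ e) (proj₂ e) ≟B true
  does-all : ∀ e → does (G? e) ∧ (does (S₂? e) ∧ does (S₁? e))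
                 ≡ adj G (proj₁ e) (proj₂ e) ∧ (lookup S (proj₂ e) ∧ lookup S (proj₁ e))
  does-all (i , j) = cong₂ _∧_ (does-≟-true (adj G i j))
    (cong₂ _∧_ (does-≟-true (lookup S j)) (does-≟-true (lookup S i)))

<ᵇ-straddle : ∀ m n s →
  (m <ᵇ n) ∧ ((m <ᵇ s) xor (n <ᵇ s)) ≡ (m <ᵇ s) ∧ not (n <ᵇ s)
<ᵇ-straddle m n s
  with m <ᵇ n | <ᵇ-reflects-< m n | m <ᵇ s | <ᵇ-reflects-< m s | n <ᵇ s | <ᵇ-reflects-< n s
... | false | ofⁿ m≮n | true  | ofʸ m<s | false | ofⁿ n≮s = contradiction (<-≤-trans m<s (≮⇒≥ n≮s)) m≮n
... | true  | ofʸ m<n | false | ofⁿ m≮s | true  | ofʸ n<s = contradiction (<-trans m<n n<s) m≮s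
... | false | _       | false | _       | _     | _       = refl
... | false | _       | true  | _       | true  | _       = refl
... | true  | _       | true  | _       | _     | _       = refl
... | true  | _       | false | _       | false | _       = refl

count∈ : ∀ {n} → (Fin n → Bool) → Subset n → ℕ
count∈ {n} c S = countᵇ (λ i → c i ∧ lookup S i) (allFin n)

∣p∣≡count∈+count∈ : ∀ {n} (c : Fin n → Bool) (p : Subset n) →
  ∣ p ∣ ≡ count∈ c p + count∈ (not ∘ c) p
∣p∣≡count∈+count∈ {n} c p = trans (∣p∣≡countᵇ p) (countᵇ-split c (lookup p) (allFin n))

inducedEdges-K : ∀ s t (S : Subset (s + t)) →
  inducedEdges (K s t) S ≡ count∈ (inFirst {s} {t}) S * count∈ (not ∘ inFirst {s} {t}) S
inducedEdges-K s t S = begin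
  inducedEdges (K s t) S
    ≡⟨ inducedEdges≡countᵇ (K s t) S ⟩
  countᵇ (λ e → (f (proj₁ e) xor f (proj₂ e)) ∧ (x (proj₂ e) ∧ x (proj₁ e))) (orderedPairs (s + t))
    ≡⟨ countᵇ-orderedPairs (λ e → (f (proj₁ e) xor f (proj₂ e)) ∧ (x (proj₂ e) ∧ x (proj₁ e))) ⟩
  sum (map (λ i → countᵇ (λ j → (toℕ i <ᵇ toℕ j) ∧ ((f i xor f j) ∧ (x j ∧ x i))) V) V)
    ≡⟨ cong sum (map-cong (λ i → countᵇ-cong (rearrange i) V) V) ⟩
  sum (map (λ i → countᵇ (λ j → (f i ∧ x i) ∧ (not (f j) ∧ x j)) V) V)
    ≡⟨ sum-countᵇ-∧ (λ i → f i ∧ x i) (λ j → not (f j) ∧ x j) V V ⟩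
  count∈ f S * count∈ (not ∘ f) S ∎
  where
  V : List (Fin (s + t))
  V = allFin (s + t)
  f x : Fin (s + t) → Bool
  f = inFirst {s} {t}
  x = lookup S
  rearrange : ∀ i j → (toℕ i <ᵇ toℕ j) ∧ ((f i xor f j) ∧ (x j ∧ x i))
                    ≡ (f i ∧ x i) ∧ (not (f j) ∧ x j)
  rearrange i j = begin
    (toℕ i <ᵇ toℕ j) ∧ ((f i xor f j) ∧ (x j ∧ x i))
      ≡⟨ ∧-assoc (toℕ i <ᵇ toℕ j) (f i xor f j) (x j ∧ x i) ⟨
    ((toℕ i <ᵇ toℕ j) ∧ (f i xor f j)) ∧ (x j ∧ x i)
      ≡⟨ cong₂ _∧_ (<ᵇ-straddle (toℕ i) (toℕ j) s) (∧-comm (x j) (x i)) ⟩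
    (f i ∧ not (f j)) ∧ (x i ∧ x j)
      ≡⟨ interchange (f i) (not (f j)) (x i) (x j) ⟩
    (f i ∧ x i) ∧ (not (f j) ∧ x j) ∎

2∤n⇒n%2≡1 : ∀ n → ¬ 2 ∣ n → n % 2 ≡ 1
2∤n⇒n%2≡1 n 2∤n with n % 2 | m%n<n n 2 | m%n≡0⇒n∣m n 2
... | 0           | _                | 2∣n = contradiction (2∣n refl) 2∤n
... | 1           | _                | _   = refl
... | suc (suc _) | s≤s (s≤s ())     | _

2∤m+n⇒2∣m*n : ∀ m n → ¬ 2 ∣ m + n → 2 ∣ m * n
2∤m+n⇒2∣m*n m n 2∤m+n with 2 ∣? m | 2 ∣? n
... | yes 2∣m | _       = ∣m⇒∣m*n n 2∣m
... | no _    | yes 2∣n = ∣n⇒∣m*n m 2∣n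
... | no 2∤m  | no 2∤n  = contradiction (m%n≡0⇒n∣m (m + n) 2 m+n%2≡0) 2∤m+n
  where
  m+n%2≡0 : (m + n) % 2 ≡ 0
  m+n%2≡0 = begin
    (m + n) % 2           ≡⟨ %-distribˡ-+ m n 2 ⟩
    (m % 2 + n % 2) % 2   ≡⟨ cong₂ (λ a b → (a + b) % 2) (2∤n⇒n%2≡1 m 2∤m) (2∤n⇒n%2≡1 n 2∤n) ⟩
    0                     ∎

theorem8 : (r s t : ℕ) → 3 ≤ r → ¬ (2 ∣ r) → 1 ≤ s → 1 ≤ t → r ≤ s + t →
    Void r (K s t)
theorem8 r s t _ 2∤r _ _ _ S ∣S∣≡r =
  subst (2 ∣_) (sym (inducedEdges-K s t S)) (2∤m+n⇒2∣m*n a b 2∤a+b)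
  where
  a b : ℕ
  a = count∈ (inFirst {s} {t}) S
  b = count∈ (not ∘ inFirst {s} {t}) S
  2∤a+b : ¬ 2 ∣ a + b
  2∤a+b = subst (λ m → ¬ 2 ∣ m) (trans (sym ∣S∣≡r) (∣p∣≡count∈+count∈ (inFirst {s} {t}) S)) 2∤r
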